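{- Let $R$ be a commutative Noetherian ring and $n$ a positive integer. Let $\Phi$ be a set of polynomials in $R[x_1,\dots,x_n]$ such that every finite subset of $\Phi$ has a common solution, i.e. for each finite $\mathcal F\subseteq\Phi$ there is $u\in R^n$ with $f(u)=0$ for all $f\in\mathcal F$. Then $\Phi$ has a common solution: there exists $u\in R^n$ with $f(u)=0$ for all $f\in\Phi$. -}

module Defs where

open import Level using (Level; _⊔_) renaming (suc to lsuc)
open import Algebra.Bundles using (CommutativeRing)
open import Data.Nat using (ℕ; zero; suc)
open import Data.List using (List; []; _∷_; foldr; zipWith)
open import Data.Vec using (Vec; []; _∷_)
open import Data.Product using (Σ; ∃; _×_; _,_)

module _ {c ℓ : Level} (R : CommutativeRing c ℓ) where
  open CommutativeRing R

  Σ-list : List Carrier → Carrier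
  Σ-list = foldr _+_ 0#

  record IsIdeal (I : Carrier → Set (c ⊔ ℓ)) : Set (c ⊔ ℓ) where
    field
      resp   : ∀ {x y} → x ≈ y → I x → I y
      zero∈  : I 0#
      +-closed : ∀ {x y} → I x → I y → I (x + y)
      *-closed : ∀ r {x} → I x → I (r * x)

  InSpan : List Carrier → Carrier → Set (c ⊔ ℓ)
  InSpan gs x = Σ (List Carrier) λ cs → x ≈ Σ-list (zipWith _*_ cs gs)

  FinitelyGenerated : (Carrier → Set (c ⊔ ℓ)) → Set (c ⊔ ℓ)
  FinitelyGenerated I =
    Σ (List Carrier) λ gs →
      (∀ x → I x → InSpan gs x) × (∀ x → InSpan gs x → I x)

  IsNoetherian : Set (lsuc (c ⊔ ℓ))
  IsNoetherian = ∀ (I : Carrier → Set (c ⊔ ℓ)) → IsIdeal I → FinitelyGenerated I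

  -- Polynomials in n variables over R, via R[x₁,…,xₙ] = R[x₂,…,xₙ][x₁]:
  -- Poly 0 = R, Poly (n+1) = coefficient lists (lowest degree first) in x₁
  -- with coefficients in Poly n.
  Poly : ℕ → Set c
  Poly zero    = Carrier
  Poly (suc n) = List (Poly n)

  eval : ∀ {n} → Poly n → Vec Carrier n → Carrier
  eval {zero}  a  []       = a
  eval {suc n} ps (x ∷ xs) = foldr (λ p acc → eval p xs + x * acc) 0# ps

-- By Hilbert's basis theorem, proved constructively by induction on the number of variables, the ideal
-- generated by Φ is finitely generated.  Each generator is a combination of finitely many members of Φ,
-- so a finite F ⊆ Φ already generates that ideal, and a common solution of F is one of all of Φ.
--
-- In the induction step, for an ideal J of polynomials in x₁ over the remaining variables, the ideals
-- Lead d of leading coefficients of the members of J of degree d grow with d and stabilise at some K,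
-- because their union is finitely generated.  Lifting generators of Lead d, d ≤ K, to members of J
-- gives a finite G ⊆ J, and every member of J lies in the ideal ⟨ G ⟩: cancel its top coefficient
-- against a member of ⟨ G ⟩ of the same degree and recurse on the lower-degree remainder.
module Submission where

open import Defs
open import Level using (_⊔_) renaming (suc to lsuc)
open import Algebra.Bundles using (CommutativeRing)
open import Data.Nat as ℕ using (ℕ; zero; suc; _∸_; _≤_; z≤n; s≤s; _≤?_)
open import Data.Nat.Properties
  using (≤-refl; ≤-trans; ≤-reflexive; ≰⇒>; <⇒≤; ⊔-lub; m≤m⊔n; m≤n⊔m; m∸n+n≡m; +-suc;
         +-monoʳ-≤)
open import Data.List using (List; []; _∷_; _++_; map; zipWith; concatMap; upTo)
open import Data.List.Membership.Propositional using (_∈_)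
open import Data.List.Membership.Propositional.Properties
  using (∈-++⁺ˡ; ∈-++⁺ʳ; ∈-map⁺; ∈-concat⁺′; ∈-upTo⁺)
open import Data.List.Relation.Unary.All as All using (All; []; _∷_)
open import Data.List.Relation.Unary.All.Properties using (++⁺; map⁺; map⁻; concat⁺)
open import Data.List.Relation.Unary.Any using (here; there)
open import Data.Vec using (Vec; []; _∷_)
open import Data.Product using (∃; _×_; _,_; proj₁; proj₂)
open import Relation.Nullary using (yes; no)
open import Relation.Binary.PropositionalEquality as ≡ using (_≡_; subst)
import Relation.Binary.Reasoning.Setoid as ≈-Reasoning

module _ {a b} {A : Set a} {B : Set b} where

  choose : ∀ {p q} {P : A → B → Set p} {Q : B → Set q} {xs : List A} →
           All (λ x → ∃ λ y → Q y × P x y) xs →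
           ∃ λ (ys : List B) → All Q ys × (∀ {x} → x ∈ xs → ∃ λ y → y ∈ ys × P x y)
  choose []                    = [] , [] , λ ()
  choose ((y , Qy , Pxy) ∷ Ps) =
    let ys , Qys , pick = choose Ps
    in y ∷ ys , Qy ∷ Qys , λ { (here ≡.refl) → y , here ≡.refl , Pxy
                             ; (there x∈xs)  → let z , z∈ys , Pxz = pick x∈xs in z , there z∈ys , Pxz }

module _ {a p} {A : Set a} {P : ℕ → A → Set p}
         (mono : ∀ {d d′ x} → d ≤ d′ → P d x → P d′ x) where

  All-∃-bound : ∀ {xs} → All (λ x → ∃ λ d → P d x) xs → ∃ λ K → All (P K) xs
  All-∃-bound []              = 0 , []
  All-∃-bound ((d , Pdx) ∷ Ps) =
    let K , PKs = All-∃-bound Ps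
    in d ℕ.⊔ K , mono (m≤m⊔n d K) Pdx ∷ All.map (mono (m≤n⊔m d K)) PKs

module _ {c ℓ} (R : CommutativeRing c ℓ) where
  open CommutativeRing R hiding (zero)
  open import Algebra.Properties.CommutativeSemigroup +-commutativeSemigroup using (interchange)
  open import Algebra.Properties.CommutativeSemigroup *-commutativeSemigroup using (x∙yz≈y∙xz)
  open import Algebra.Properties.Ring ring using (-1*x≈-x; -0#≈0#; -‿distribʳ-*)
  open import Algebra.Properties.AbelianGroup +-abelianGroup using (⁻¹-∙-comm)

  -- Pol n is Poly R n as an inductive family, so that n can be inferred from the type of a polynomial.
  data Pol : ℕ → Set c where
    const : Carrier → Pol zero
    []    : ∀ {n} → Pol (suc n)
    _∷_   : ∀ {n} → Pol n → Pol (suc n) → Pol (suc n)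

  ⟦_⟧ : ∀ {n} → Pol n → Vec Carrier n → Carrier
  ⟦ const a ⟧ []       = a
  ⟦ []      ⟧ (x ∷ xs) = 0#
  ⟦ p ∷ ps  ⟧ (x ∷ xs) = ⟦ p ⟧ xs + x * ⟦ ps ⟧ (x ∷ xs)

  -- Polynomials are compared as functions Rⁿ → R.  This is coarser than equality of coefficients, but
  -- only the common zeros of an ideal matter here.
  infix 4 _≋_
  record _≋_ {n} (f g : Pol n) : Set (c ⊔ ℓ) where
    constructor mk≋
    field at : ∀ u → ⟦ f ⟧ u ≈ ⟦ g ⟧ u
  open _≋_ public

  ≋-refl : ∀ {n} {f : Pol n} → f ≋ f
  ≋-refl = mk≋ λ u → refl

  ≋-sym : ∀ {n} {f g : Pol n} → f ≋ g → g ≋ f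
  ≋-sym f≋g = mk≋ λ u → sym (at f≋g u)

  ≋-trans : ∀ {n} {f g h : Pol n} → f ≋ g → g ≋ h → f ≋ h
  ≋-trans f≋g g≋h = mk≋ λ u → trans (at f≋g u) (at g≋h u)

  0ₚ : ∀ {n} → Pol n
  0ₚ {zero}  = const 0#
  0ₚ {suc n} = []

  constₚ : ∀ {n} → Carrier → Pol n
  constₚ {zero}  r = const r
  constₚ {suc n} r = constₚ r ∷ []

  X : ∀ {n} → Pol (suc n)
  X = 0ₚ ∷ constₚ 1#

  infixl 7 _*ₚ_ _·ₚ_
  infixl 6 _+ₚ_ _-ₚ_
  infix  8 -ₚ_

  _+ₚ_ : ∀ {n} → Pol n → Pol n → Pol n
  const a  +ₚ const b  = const (a + b)
  []       +ₚ qs       = qs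
  (p ∷ ps) +ₚ []       = p ∷ ps
  (p ∷ ps) +ₚ (q ∷ qs) = p +ₚ q ∷ ps +ₚ qs

  -ₚ_ : ∀ {n} → Pol n → Pol n
  -ₚ const a  = const (- a)
  -ₚ []       = []
  -ₚ (p ∷ ps) = -ₚ p ∷ -ₚ ps

  _-ₚ_ : ∀ {n} → Pol n → Pol n → Pol n
  f -ₚ g = f +ₚ -ₚ g

  _·ₚ_ : ∀ {n} → Pol n → Pol (suc n) → Pol (suc n)
  _*ₚ_ : ∀ {n} → Pol n → Pol n → Pol n

  h ·ₚ []       = []
  h ·ₚ (p ∷ ps) = h *ₚ p ∷ h ·ₚ ps

  const a  *ₚ const b = const (a * b)
  []       *ₚ qs      = []
  (p ∷ ps) *ₚ qs      = p ·ₚ qs +ₚ (0ₚ ∷ ps *ₚ qs)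

  length : ∀ {n} → Pol (suc n) → ℕ
  length []       = 0
  length (p ∷ ps) = suc (length ps)

  take : ∀ {n} → ℕ → Pol (suc n) → Pol (suc n)
  take zero    f        = []
  take (suc d) []       = []
  take (suc d) (p ∷ ps) = p ∷ take d ps

  coeff : ∀ {n} → ℕ → Pol (suc n) → Pol n
  coeff d       []       = 0ₚ
  coeff zero    (p ∷ ps) = p
  coeff (suc d) (p ∷ ps) = coeff d ps

  shift : ∀ {n} → ℕ → Pol (suc n) → Pol (suc n)
  shift zero    f = f
  shift (suc e) f = 0ₚ ∷ shift e f

  +-horner : ∀ a b s t x → (a + b) + x * (s + t) ≈ (a + x * s) + (b + x * t)
  +-horner a b s t x = trans (+-congˡ (distribˡ x s t)) (interchange a b (x * s) (x * t))

  -‿horner : ∀ a s x → - a + x * - s ≈ - (a + x * s)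
  -‿horner a s x = trans (+-congˡ (sym (-‿distribʳ-* x s))) (⁻¹-∙-comm a (x * s))

  ·-horner : ∀ h a s x → h * a + x * (h * s) ≈ h * (a + x * s)
  ·-horner h a s x = trans (+-congˡ (x∙yz≈y∙xz x h s)) (sym (distribˡ h a (x * s)))

  *-horner : ∀ a s b x → a * b + (0# + x * (s * b)) ≈ (a + x * s) * b
  *-horner a s b x = trans (+-congˡ (trans (+-identityˡ _) (sym (*-assoc x s b)))) (sym (distribʳ b a (x * s)))

  eval-0ₚ : ∀ {n} (u : Vec Carrier n) → ⟦ 0ₚ ⟧ u ≈ 0#
  eval-0ₚ []       = refl
  eval-0ₚ (x ∷ xs) = refl

  eval-constₚ : ∀ {n} r (u : Vec Carrier n) → ⟦ constₚ r ⟧ u ≈ r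
  eval-constₚ r []       = refl
  eval-constₚ r (x ∷ xs) = trans (+-cong (eval-constₚ r xs) (zeroʳ x)) (+-identityʳ r)

  eval-X : ∀ {n} x (xs : Vec Carrier n) → ⟦ X ⟧ (x ∷ xs) ≈ x
  eval-X x xs =
    trans (+-cong (eval-0ₚ xs) (*-congˡ (eval-constₚ 1# (x ∷ xs)))) (trans (+-identityˡ _) (*-identityʳ x))

  eval-+ₚ : ∀ {n} (f g : Pol n) u → ⟦ f +ₚ g ⟧ u ≈ ⟦ f ⟧ u + ⟦ g ⟧ u
  eval-+ₚ (const a) (const b) []       = refl
  eval-+ₚ []        g         (x ∷ xs) = sym (+-identityˡ _)
  eval-+ₚ (p ∷ ps)  []        (x ∷ xs) = sym (+-identityʳ _)
  eval-+ₚ (p ∷ ps)  (q ∷ qs)  (x ∷ xs) =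
    trans (+-cong (eval-+ₚ p q xs) (*-congˡ (eval-+ₚ ps qs (x ∷ xs)))) (+-horner _ _ _ _ x)

  eval--ₚ : ∀ {n} (f : Pol n) u → ⟦ -ₚ f ⟧ u ≈ - ⟦ f ⟧ u
  eval--ₚ (const a) []       = refl
  eval--ₚ []        (x ∷ xs) = sym -0#≈0#
  eval--ₚ (p ∷ ps)  (x ∷ xs) =
    trans (+-cong (eval--ₚ p xs) (*-congˡ (eval--ₚ ps (x ∷ xs)))) (-‿horner _ _ x)

  eval-·ₚ : ∀ {n} (h : Pol n) f x xs → ⟦ h ·ₚ f ⟧ (x ∷ xs) ≈ ⟦ h ⟧ xs * ⟦ f ⟧ (x ∷ xs)
  eval-*ₚ : ∀ {n} (f g : Pol n) u → ⟦ f *ₚ g ⟧ u ≈ ⟦ f ⟧ u * ⟦ g ⟧ u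

  eval-·ₚ h []       x xs = sym (zeroʳ _)
  eval-·ₚ h (p ∷ ps) x xs =
    trans (+-cong (eval-*ₚ h p xs) (*-congˡ (eval-·ₚ h ps x xs))) (·-horner _ _ _ x)

  eval-*ₚ (const a) (const b) []       = refl
  eval-*ₚ []        g         (x ∷ xs) = sym (zeroˡ _)
  eval-*ₚ (p ∷ ps)  g         (x ∷ xs) =
    trans (eval-+ₚ (p ·ₚ g) (0ₚ ∷ ps *ₚ g) (x ∷ xs))
          (trans (+-cong (eval-·ₚ p g x xs) (+-cong (eval-0ₚ xs) (*-congˡ (eval-*ₚ ps g (x ∷ xs)))))
                 (*-horner _ _ _ x))

  +ₚ-cong : ∀ {n} {f f′ g g′ : Pol n} → f ≋ f′ → g ≋ g′ → f +ₚ g ≋ f′ +ₚ g′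
  +ₚ-cong {f = f} {f′} {g} {g′} f≋f′ g≋g′ = mk≋ λ u →
    trans (eval-+ₚ f g u) (trans (+-cong (at f≋f′ u) (at g≋g′ u)) (sym (eval-+ₚ f′ g′ u)))

  *ₚ-congˡ : ∀ {n} (h : Pol n) {f g} → f ≋ g → h *ₚ f ≋ h *ₚ g
  *ₚ-congˡ h {f} {g} f≋g = mk≋ λ u →
    trans (eval-*ₚ h f u) (trans (*-congˡ (at f≋g u)) (sym (eval-*ₚ h g u)))

  +ₚ-identityˡ : ∀ {n} (f : Pol n) → 0ₚ +ₚ f ≋ f
  +ₚ-identityˡ f = mk≋ λ u → trans (eval-+ₚ 0ₚ f u) (trans (+-congʳ (eval-0ₚ u)) (+-identityˡ _))

  +ₚ-identityʳ : ∀ {n} (f : Pol n) → f +ₚ 0ₚ ≋ f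
  +ₚ-identityʳ f = mk≋ λ u → trans (eval-+ₚ f 0ₚ u) (trans (+-congˡ (eval-0ₚ u)) (+-identityʳ _))

  -ₚ0ₚ : ∀ {n} → -ₚ 0ₚ ≋ 0ₚ {n}
  -ₚ0ₚ = mk≋ λ u →
    trans (eval--ₚ 0ₚ u) (trans (-‿cong (eval-0ₚ u)) (trans -0#≈0# (sym (eval-0ₚ u))))

  *ₚ-zeroʳ : ∀ {n} (h : Pol n) → h *ₚ 0ₚ ≋ 0ₚ
  *ₚ-zeroʳ h = mk≋ λ u →
    trans (eval-*ₚ h 0ₚ u) (trans (*-congˡ (eval-0ₚ u)) (trans (zeroʳ _) (sym (eval-0ₚ u))))

  -ₚ-+ₚ-cancel : ∀ {n} (f g : Pol n) → f -ₚ g +ₚ g ≋ f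
  -ₚ-+ₚ-cancel f g = mk≋ λ u → begin
    ⟦ f -ₚ g +ₚ g ⟧ u               ≈⟨ eval-+ₚ (f -ₚ g) g u ⟩
    ⟦ f -ₚ g ⟧ u + ⟦ g ⟧ u          ≈⟨ +-congʳ (trans (eval-+ₚ f (-ₚ g) u) (+-congˡ (eval--ₚ g u))) ⟩
    ⟦ f ⟧ u - ⟦ g ⟧ u + ⟦ g ⟧ u     ≈⟨ +-assoc _ _ _ ⟩
    ⟦ f ⟧ u + (- ⟦ g ⟧ u + ⟦ g ⟧ u) ≈⟨ +-congˡ (-‿inverseˡ _) ⟩
    ⟦ f ⟧ u + 0#                    ≈⟨ +-identityʳ _ ⟩
    ⟦ f ⟧ u                         ∎
    where open ≈-Reasoning setoid

  ∷[]-*ₚ : ∀ {n} (h : Pol n) f → (h ∷ []) *ₚ f ≋ h ·ₚ f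
  ∷[]-*ₚ h f = mk≋ λ { (x ∷ xs) →
    trans (eval-*ₚ (h ∷ []) f (x ∷ xs))
          (trans (*-congʳ (trans (+-congˡ (zeroʳ x)) (+-identityʳ _))) (sym (eval-·ₚ h f x xs))) }

  X-*ₚ : ∀ {n} (f : Pol (suc n)) → X *ₚ f ≋ 0ₚ ∷ f
  X-*ₚ f = mk≋ λ { (x ∷ xs) →
    trans (eval-*ₚ X f (x ∷ xs))
          (trans (*-congʳ (eval-X x xs)) (sym (trans (+-congʳ (eval-0ₚ xs)) (+-identityˡ _)))) }

  -1-*ₚ : ∀ {n} (f : Pol n) → constₚ (- 1#) *ₚ f ≋ -ₚ f
  -1-*ₚ f = mk≋ λ u →
    trans (eval-*ₚ (constₚ (- 1#)) f u)
          (trans (*-congʳ (eval-constₚ (- 1#) u)) (trans (-1*x≈-x _) (sym (eval--ₚ f u))))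

  coeff-+ₚ : ∀ {n} d (f g : Pol (suc n)) → coeff d (f +ₚ g) ≋ coeff d f +ₚ coeff d g
  coeff-+ₚ d       []       g        = ≋-sym (+ₚ-identityˡ (coeff d g))
  coeff-+ₚ d       (p ∷ ps) []       = ≋-sym (+ₚ-identityʳ (coeff d (p ∷ ps)))
  coeff-+ₚ zero    (p ∷ ps) (q ∷ qs) = ≋-refl
  coeff-+ₚ (suc d) (p ∷ ps) (q ∷ qs) = coeff-+ₚ d ps qs

  coeff--ₚ : ∀ {n} d (f : Pol (suc n)) → coeff d (-ₚ f) ≋ -ₚ coeff d f
  coeff--ₚ d       []       = ≋-sym -ₚ0ₚ
  coeff--ₚ zero    (p ∷ ps) = ≋-refl
  coeff--ₚ (suc d) (p ∷ ps) = coeff--ₚ d ps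

  coeff-·ₚ : ∀ {n} d (h : Pol n) (f : Pol (suc n)) → coeff d (h ·ₚ f) ≋ h *ₚ coeff d f
  coeff-·ₚ d       h []       = ≋-sym (*ₚ-zeroʳ h)
  coeff-·ₚ zero    h (p ∷ ps) = ≋-refl
  coeff-·ₚ (suc d) h (p ∷ ps) = coeff-·ₚ d h ps

  coeff-shift : ∀ {n} e d (f : Pol (suc n)) → coeff (e ℕ.+ d) (shift e f) ≡ coeff d f
  coeff-shift zero    d f = ≡.refl
  coeff-shift (suc e) d f = coeff-shift e d f

  length-+ₚ : ∀ {n} (f g : Pol (suc n)) → length (f +ₚ g) ≡ length f ℕ.⊔ length g
  length-+ₚ []       g        = ≡.refl
  length-+ₚ (p ∷ ps) []       = ≡.refl
  length-+ₚ (p ∷ ps) (q ∷ qs) = ≡.cong suc (length-+ₚ ps qs)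

  length--ₚ : ∀ {n} (f : Pol (suc n)) → length (-ₚ f) ≡ length f
  length--ₚ []       = ≡.refl
  length--ₚ (p ∷ ps) = ≡.cong suc (length--ₚ ps)

  length-·ₚ : ∀ {n} (h : Pol n) f → length (h ·ₚ f) ≡ length f
  length-·ₚ h []       = ≡.refl
  length-·ₚ h (p ∷ ps) = ≡.cong suc (length-·ₚ h ps)

  length-shift : ∀ {n} e (f : Pol (suc n)) → length (shift e f) ≡ e ℕ.+ length f
  length-shift zero    f = ≡.refl
  length-shift (suc e) f = ≡.cong suc (length-shift e f)

  length-take : ∀ {n} d (f : Pol (suc n)) → length (take d f) ≤ d
  length-take zero    f        = z≤n
  length-take (suc d) []       = z≤n
  length-take (suc d) (p ∷ ps) = s≤s (length-take d ps)

  take-≋ : ∀ {n} d (f : Pol (suc n)) → length f ≤ suc d → coeff d f ≋ 0ₚ → f ≋ take d f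
  take-≋ zero    []           _         _     = ≋-refl
  take-≋ zero    (p ∷ [])     _         p≋0   = mk≋ λ { (x ∷ xs) →
    trans (+-cong (trans (at p≋0 xs) (eval-0ₚ xs)) (zeroʳ x)) (+-identityʳ 0#) }
  take-≋ zero    (p ∷ q ∷ qs) (s≤s ())  _
  take-≋ (suc d) []           _         _     = ≋-refl
  take-≋ (suc d) (p ∷ ps)     (s≤s len) top≋0 = mk≋ λ { (x ∷ xs) →
    +-congˡ (*-congˡ (at (take-≋ d ps len top≋0) (x ∷ xs))) }

  take-cancel : ∀ {n} d (f g : Pol (suc n)) → length f ≤ suc d → length g ≤ suc d →
                coeff d f ≋ coeff d g → f -ₚ g ≋ take d (f -ₚ g)
  take-cancel d f g lf lg top≋ = take-≋ d (f -ₚ g) len top≋0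
    where
    len : length (f -ₚ g) ≤ suc d
    len = ≤-trans (≤-reflexive (length-+ₚ f (-ₚ g)))
                  (⊔-lub lf (≤-trans (≤-reflexive (length--ₚ g)) lg))

    top≋0 : coeff d (f -ₚ g) ≋ 0ₚ
    top≋0 = mk≋ λ u → begin
      ⟦ coeff d (f -ₚ g) ⟧ u                ≈⟨ at (coeff-+ₚ d f (-ₚ g)) u ⟩
      ⟦ coeff d f +ₚ coeff d (-ₚ g) ⟧ u     ≈⟨ eval-+ₚ (coeff d f) (coeff d (-ₚ g)) u ⟩
      ⟦ coeff d f ⟧ u + ⟦ coeff d (-ₚ g) ⟧ u ≈⟨ +-cong (at top≋ u) (at (coeff--ₚ d g) u) ⟩
      ⟦ coeff d g ⟧ u + ⟦ -ₚ coeff d g ⟧ u  ≈⟨ +-congˡ (eval--ₚ (coeff d g) u) ⟩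
      ⟦ coeff d g ⟧ u - ⟦ coeff d g ⟧ u     ≈⟨ -‿inverseʳ _ ⟩
      0#                                    ≈⟨ eval-0ₚ u ⟨
      ⟦ 0ₚ ⟧ u                              ∎
      where open ≈-Reasoning setoid

  record IsIdealₚ {n p} (I : Pol n → Set p) : Set (c ⊔ ℓ ⊔ p) where
    field
      resp     : ∀ {f g} → f ≋ g → I f → I g
      zero∈    : I 0ₚ
      +-closed : ∀ {f g} → I f → I g → I (f +ₚ g)
      *-closed : ∀ h {f} → I f → I (h *ₚ f)

    -‿closed : ∀ {f} → I f → I (-ₚ f)
    -‿closed {f} If = resp (-1-*ₚ f) (*-closed (constₚ (- 1#)) If)

    sub-closed : ∀ {f g} → I f → I g → I (f -ₚ g)
    sub-closed If Ig = +-closed If (-‿closed Ig)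

  module _ {n p} {I : Pol (suc n) → Set p} (isI : IsIdealₚ I) where
    open IsIdealₚ isI

    ·-closed : ∀ h {f} → I f → I (h ·ₚ f)
    ·-closed h {f} If = resp (∷[]-*ₚ h f) (*-closed (h ∷ []) If)

    shift-closed : ∀ e {f} → I f → I (shift e f)
    shift-closed zero    If = If
    shift-closed (suc e) {f} If = resp (X-*ₚ (shift e f)) (*-closed X (shift-closed e If))

  data ⟨_⟩ {n} (gs : List (Pol n)) : Pol n → Set (c ⊔ ℓ) where
    gen  : ∀ {g} → g ∈ gs → ⟨ gs ⟩ g
    0∈   : ⟨ gs ⟩ 0ₚ
    _+∈_ : ∀ {f g} → ⟨ gs ⟩ f → ⟨ gs ⟩ g → ⟨ gs ⟩ (f +ₚ g)
    _*∈_ : ∀ h {f} → ⟨ gs ⟩ f → ⟨ gs ⟩ (h *ₚ f)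
    ≋∈   : ∀ {f g} → f ≋ g → ⟨ gs ⟩ f → ⟨ gs ⟩ g

  ⟨⟩-isIdeal : ∀ {n} {gs : List (Pol n)} → IsIdealₚ ⟨ gs ⟩
  ⟨⟩-isIdeal = record { resp = ≋∈ ; zero∈ = 0∈ ; +-closed = _+∈_ ; *-closed = _*∈_ }

  ⟨⟩-least : ∀ {n p} {I : Pol n → Set p} {gs} → IsIdealₚ I → All I gs →
             ∀ {f} → ⟨ gs ⟩ f → I f
  ⟨⟩-least isI Igs (gen g∈gs)  = All.lookup Igs g∈gs
  ⟨⟩-least isI Igs 0∈          = IsIdealₚ.zero∈ isI
  ⟨⟩-least isI Igs (s +∈ t)    = IsIdealₚ.+-closed isI (⟨⟩-least isI Igs s) (⟨⟩-least isI Igs t)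
  ⟨⟩-least isI Igs (h *∈ s)    = IsIdealₚ.*-closed isI h (⟨⟩-least isI Igs s)
  ⟨⟩-least isI Igs (≋∈ f≋g s)  = IsIdealₚ.resp isI f≋g (⟨⟩-least isI Igs s)

  ⟨⟩-mono : ∀ {n} {gs hs : List (Pol n)} → (∀ {g} → g ∈ gs → g ∈ hs) →
            ∀ {f} → ⟨ gs ⟩ f → ⟨ hs ⟩ f
  ⟨⟩-mono gs⊆hs = ⟨⟩-least ⟨⟩-isIdeal (All.tabulate (λ g∈gs → gen (gs⊆hs g∈gs)))

  VanishesAt : ∀ {n} → Vec Carrier n → Pol n → Set ℓ
  VanishesAt u f = ⟦ f ⟧ u ≈ 0#

  VanishesAt-isIdeal : ∀ {n} (u : Vec Carrier n) → IsIdealₚ (VanishesAt u)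
  VanishesAt-isIdeal u = record
    { resp     = λ f≋g f0 → trans (sym (at f≋g u)) f0
    ; zero∈    = eval-0ₚ u
    ; +-closed = λ {f} {g} f0 g0 → trans (eval-+ₚ f g u) (trans (+-cong f0 g0) (+-identityʳ 0#))
    ; *-closed = λ h {f} f0 → trans (eval-*ₚ h f u) (trans (*-congˡ f0) (zeroʳ _))
    }

  -- As length f ≤ suc d says deg f ≤ d, Lead I d is the ideal of leading coefficients of the degree-d
  -- members of I (together with 0).
  Lead : ∀ {n p} → (Pol (suc n) → Set p) → ℕ → Pol n → Set (c ⊔ ℓ ⊔ p)
  Lead I d a = ∃ λ f → I f × length f ≤ suc d × a ≋ coeff d f

  Lead∞ : ∀ {n p} → (Pol (suc n) → Set p) → Pol n → Set (c ⊔ ℓ ⊔ p)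
  Lead∞ I a = ∃ λ d → Lead I d a

  module _ {n p} {I : Pol (suc n) → Set p} (isI : IsIdealₚ I) where
    open IsIdealₚ isI

    Lead-isIdeal : ∀ d → IsIdealₚ (Lead I d)
    Lead-isIdeal d = record
      { resp     = λ { a≋b (f , If , len , a≋) → f , If , len , ≋-trans (≋-sym a≋b) a≋ }
      ; zero∈    = [] , zero∈ , z≤n , ≋-refl
      ; +-closed = λ { (f , If , lf , a≋) (g , Ig , lg , b≋) →
          f +ₚ g , +-closed If Ig , ≤-trans (≤-reflexive (length-+ₚ f g)) (⊔-lub lf lg) ,
          ≋-trans (+ₚ-cong a≋ b≋) (≋-sym (coeff-+ₚ d f g)) }
      ; *-closed = λ { h (f , If , len , a≋) →
          h ·ₚ f , ·-closed isI h If , ≤-trans (≤-reflexive (length-·ₚ h f)) len ,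
          ≋-trans (*ₚ-congˡ h a≋) (≋-sym (coeff-·ₚ d h f)) }
      }

    Lead-shift : ∀ e {d a} → Lead I d a → Lead I (e ℕ.+ d) a
    Lead-shift e {d} {a} (f , If , len , a≋) =
      shift e f , shift-closed isI e If ,
      ≤-trans (≤-reflexive (length-shift e f)) (≤-trans (+-monoʳ-≤ e len) (≤-reflexive (+-suc e d))) ,
      subst (a ≋_) (≡.sym (coeff-shift e d f)) a≋

    Lead-mono : ∀ {d d′ a} → d ≤ d′ → Lead I d a → Lead I d′ a
    Lead-mono {d} {d′} {a} d≤d′ l =
      subst (λ k → Lead I k a) (m∸n+n≡m d≤d′) (Lead-shift (d′ ∸ d) l)

    Lead∞-isIdeal : IsIdealₚ (Lead∞ I)
    Lead∞-isIdeal = record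
      { resp     = λ { a≋b (d , l) → d , IsIdealₚ.resp (Lead-isIdeal d) a≋b l }
      ; zero∈    = 0 , IsIdealₚ.zero∈ (Lead-isIdeal 0)
      ; +-closed = λ { (d , l) (d′ , l′) → d ℕ.⊔ d′ ,
          IsIdealₚ.+-closed (Lead-isIdeal (d ℕ.⊔ d′))
            (Lead-mono (m≤m⊔n d d′) l) (Lead-mono (m≤n⊔m d d′) l′) }
      ; *-closed = λ { h (d , l) → d , IsIdealₚ.*-closed (Lead-isIdeal d) h l }
      }

  PolyNoetherian : ℕ → Set (lsuc (c ⊔ ℓ))
  PolyNoetherian n = ∀ (I : Pol n → Set (c ⊔ ℓ)) → IsIdealₚ I →
    ∃ λ (gs : List (Pol n)) → All I gs × (∀ {f} → I f → ⟨ gs ⟩ f)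

  module HilbertBasis {n} (noeth : PolyNoetherian n) {J : Pol (suc n) → Set (c ⊔ ℓ)} (isJ : IsIdealₚ J) where
    open IsIdealₚ isJ

    Lead-stabilises : ∃ λ K → ∀ {d a} → Lead J d a → Lead J K a
    Lead-stabilises =
      let gs , gs⊆Lead∞ , Lead∞⊆⟨gs⟩ = noeth (Lead∞ J) (Lead∞-isIdeal isJ)
          K , gs⊆LeadK = All-∃-bound (Lead-mono isJ) gs⊆Lead∞
      in K , λ {d} l → ⟨⟩-least (Lead-isIdeal isJ K) gs⊆LeadK (Lead∞⊆⟨gs⟩ (d , l))

    K : ℕ
    K = proj₁ Lead-stabilises

    basis : ∀ d → ∃ λ hs → All (Lead J d) hs × (∀ {a} → Lead J d a → ⟨ hs ⟩ a)
    basis d = noeth (Lead J d) (Lead-isIdeal isJ d)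

    gens : ℕ → List (Pol n)
    gens d = proj₁ (basis d)

    Lead⊆⟨gens⟩ : ∀ d {a} → Lead J d a → ⟨ gens d ⟩ a
    Lead⊆⟨gens⟩ d = proj₂ (proj₂ (basis d))

    lifts : ∀ d → ∃ λ fs → All J fs ×
              (∀ {a} → a ∈ gens d → ∃ λ f → f ∈ fs × length f ≤ suc d × a ≋ coeff d f)
    lifts d = choose (proj₁ (proj₂ (basis d)))

    G : List (Pol (suc n))
    G = concatMap (λ d → proj₁ (lifts d)) (upTo (suc K))

    G⊆J : All J G
    G⊆J = concat⁺ (map⁺ {xs = upTo (suc K)} (All.tabulate (λ {d} _ → proj₁ (proj₂ (lifts d)))))

    gens⊆Lead⟨G⟩ : ∀ {d} → d ≤ K → All (Lead ⟨ G ⟩ d) (gens d)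
    gens⊆Lead⟨G⟩ {d} d≤K = All.tabulate λ a∈gens →
      let f , f∈lifts , len , a≋ = proj₂ (proj₂ (lifts d)) a∈gens
      in f , gen (∈-concat⁺′ f∈lifts (∈-map⁺ _ (∈-upTo⁺ (s≤s d≤K)))) , len , a≋

    ⟨gens⟩⊆Lead⟨G⟩ : ∀ e {d} → d ≤ K → ∀ {a} → ⟨ gens d ⟩ a → Lead ⟨ G ⟩ (e ℕ.+ d) a
    ⟨gens⟩⊆Lead⟨G⟩ e d≤K =
      ⟨⟩-least (Lead-isIdeal ⟨⟩-isIdeal _) (All.map (Lead-shift ⟨⟩-isIdeal e) (gens⊆Lead⟨G⟩ d≤K))

    -- Above K, Lead J D = Lead J K, so its generators are those of degree K shifted by x₁^(D ∸ K).
    LeadJ⊆Lead⟨G⟩ : ∀ D {a} → Lead J D a → Lead ⟨ G ⟩ D a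
    LeadJ⊆Lead⟨G⟩ D {a} l with D ≤? K
    ... | yes D≤K = ⟨gens⟩⊆Lead⟨G⟩ 0 D≤K (Lead⊆⟨gens⟩ D l)
    ... | no  D≰K = subst (λ k → Lead ⟨ G ⟩ k a) (m∸n+n≡m (<⇒≤ (≰⇒> D≰K)))
                    (⟨gens⟩⊆Lead⟨G⟩ (D ∸ K) ≤-refl (Lead⊆⟨gens⟩ K (proj₂ Lead-stabilises l)))

    J⊆⟨G⟩ : ∀ m {f} → J f → length f ≤ m → ⟨ G ⟩ f
    J⊆⟨G⟩ zero    {[]}    _  _  = 0∈
    J⊆⟨G⟩ (suc D) {f}     Jf lf =
      let q , q∈⟨G⟩ , lq , top≋ = LeadJ⊆Lead⟨G⟩ D (f , Jf , lf , ≋-refl)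
          f-q≋ = take-cancel D f q lf lq top≋
          J[f-q] = resp f-q≋ (sub-closed Jf (⟨⟩-least isJ G⊆J q∈⟨G⟩))
      in ≋∈ (≋-trans (+ₚ-cong (≋-sym f-q≋) ≋-refl) (-ₚ-+ₚ-cancel f q))
            (J⊆⟨G⟩ D J[f-q] (length-take D (f -ₚ q)) +∈ q∈⟨G⟩)

  hilbertBasis : ∀ {n} → PolyNoetherian n → PolyNoetherian (suc n)
  hilbertBasis noeth J isJ = G , G⊆J , λ {f} Jf → J⊆⟨G⟩ (length f) Jf ≤-refl
    where open HilbertBasis noeth isJ

  ∈⇒InSpan : ∀ {g gs} → g ∈ gs → InSpan R gs g
  ∈⇒InSpan (here ≡.refl) = 1# ∷ [] , sym (trans (+-identityʳ _) (*-identityˡ _))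
  ∈⇒InSpan (there g∈gs)  =
    let cs , g≈ = ∈⇒InSpan g∈gs in 0# ∷ cs , trans g≈ (sym (trans (+-congʳ (zeroˡ _)) (+-identityˡ _)))

  InSpan⇒⟨⟩ : ∀ {gs a} → InSpan R gs a → ⟨ map const gs ⟩ (const a)
  InSpan⇒⟨⟩ {gs} (cs , a≈) = ≋∈ (mk≋ λ { [] → sym a≈ }) (combination∈ cs gs)
    where
    combination∈ : ∀ cs gs → ⟨ map const gs ⟩ (const (Σ-list R (zipWith _*_ cs gs)))
    combination∈ []       gs       = 0∈
    combination∈ (c ∷ cs) []       = 0∈
    combination∈ (c ∷ cs) (g ∷ gs) =
      (const c *∈ gen (here ≡.refl)) +∈ ⟨⟩-mono there (combination∈ cs gs)

  IsNoetherian⇒PolyNoetherian₀ : IsNoetherian R → PolyNoetherian 0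
  IsNoetherian⇒PolyNoetherian₀ noeth I isI =
    let gs , I⊆span , span⊆I = noeth (λ a → I (const a)) isI₀
    in map const gs , map⁺ (All.tabulate λ g∈gs → span⊆I _ (∈⇒InSpan g∈gs)) ,
       λ { {const a} Ia → InSpan⇒⟨⟩ (I⊆span a Ia) }
    where
    open IsIdealₚ isI
    isI₀ : IsIdeal R (λ a → I (const a))
    isI₀ = record
      { resp     = λ a≈b → resp (mk≋ λ { [] → a≈b })
      ; zero∈    = zero∈
      ; +-closed = +-closed
      ; *-closed = λ r → *-closed (const r)
      }

  polyNoetherian : IsNoetherian R → ∀ n → PolyNoetherian n
  polyNoetherian noeth zero    = IsNoetherian⇒PolyNoetherian₀ noeth
  polyNoetherian noeth (suc n) = hilbertBasis (polyNoetherian noeth n)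

  Generated : ∀ {n} → (Pol n → Set (c ⊔ ℓ)) → Pol n → Set (c ⊔ ℓ)
  Generated Φ f = ∃ λ F → All Φ F × ⟨ F ⟩ f

  Generated-isIdeal : ∀ {n} {Φ : Pol n → Set (c ⊔ ℓ)} → IsIdealₚ (Generated Φ)
  Generated-isIdeal = record
    { resp     = λ { f≋g (F , ΦF , f∈) → F , ΦF , ≋∈ f≋g f∈ }
    ; zero∈    = [] , [] , 0∈
    ; +-closed = λ { (F , ΦF , f∈) (F′ , ΦF′ , g∈) →
        F ++ F′ , ++⁺ ΦF ΦF′ , ⟨⟩-mono ∈-++⁺ˡ f∈ +∈ ⟨⟩-mono (∈-++⁺ʳ F) g∈ }
    ; *-closed = λ { h (F , ΦF , f∈) → F , ΦF , h *∈ f∈ }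
    }

  Generated-common : ∀ {n} {Φ : Pol n → Set (c ⊔ ℓ)} {gs} →
                     All (Generated Φ) gs → ∃ λ F → All Φ F × All ⟨ F ⟩ gs
  Generated-common []                   = [] , [] , []
  Generated-common ((F , ΦF , g∈) ∷ Gs) =
    let F′ , ΦF′ , gs∈ = Generated-common Gs
    in F ++ F′ , ++⁺ ΦF ΦF′ , ⟨⟩-mono ∈-++⁺ˡ g∈ ∷ All.map (⟨⟩-mono (∈-++⁺ʳ F)) gs∈

  finiteBasis : IsNoetherian R → ∀ n (Φ : Pol n → Set (c ⊔ ℓ)) →
                ∃ λ F → All Φ F × (∀ {f} → Φ f → ⟨ F ⟩ f)
  finiteBasis noeth n Φ =
    let gs , gs⊆Gen , Gen⊆⟨gs⟩ = polyNoetherian noeth n (Generated Φ) Generated-isIdeal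
        F , ΦF , gs⊆⟨F⟩ = Generated-common gs⊆Gen
    in F , ΦF , λ {f} Φf →
         ⟨⟩-least ⟨⟩-isIdeal gs⊆⟨F⟩ (Gen⊆⟨gs⟩ (f ∷ [] , Φf ∷ [] , gen (here ≡.refl)))

  toPoly : ∀ {n} → Pol n → Poly R n
  toPoly (const a) = a
  toPoly []        = []
  toPoly (p ∷ ps)  = toPoly p ∷ toPoly ps

  fromPoly : ∀ n → Poly R n → Pol n
  fromPoly zero    a        = const a
  fromPoly (suc n) []       = []
  fromPoly (suc n) (p ∷ ps) = fromPoly n p ∷ fromPoly (suc n) ps

  toPoly-fromPoly : ∀ n (f : Poly R n) → toPoly (fromPoly n f) ≡ f
  toPoly-fromPoly zero    a        = ≡.refl
  toPoly-fromPoly (suc n) []       = ≡.refl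
  toPoly-fromPoly (suc n) (p ∷ ps) = ≡.cong₂ _∷_ (toPoly-fromPoly n p) (toPoly-fromPoly (suc n) ps)

  eval-toPoly : ∀ {n} (f : Pol n) u → eval R (toPoly f) u ≡ ⟦ f ⟧ u
  eval-toPoly (const a) []       = ≡.refl
  eval-toPoly []        (x ∷ xs) = ≡.refl
  eval-toPoly (p ∷ ps)  (x ∷ xs) =
    ≡.cong₂ (λ a b → a + x * b) (eval-toPoly p xs) (eval-toPoly ps (x ∷ xs))

  eval-fromPoly : ∀ n (f : Poly R n) u → ⟦ fromPoly n f ⟧ u ≡ eval R f u
  eval-fromPoly zero    a        []       = ≡.refl
  eval-fromPoly (suc n) []       (x ∷ xs) = ≡.refl
  eval-fromPoly (suc n) (p ∷ ps) (x ∷ xs) =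
    ≡.cong₂ (λ a b → a + x * b) (eval-fromPoly n p xs) (eval-fromPoly (suc n) ps (x ∷ xs))

  commonZero : IsNoetherian R → ∀ n (Φ : Pol n → Set (c ⊔ ℓ)) →
               ((F : List (Pol n)) → All Φ F → ∃ λ u → All (VanishesAt u) F) →
               ∃ λ u → ∀ f → Φ f → VanishesAt u f
  commonZero noeth n Φ solvable =
    let F , ΦF , Φ⊆⟨F⟩ = finiteBasis noeth n Φ
        u , F-vanish    = solvable F ΦF
    in u , λ f Φf → ⟨⟩-least (VanishesAt-isIdeal u) F-vanish (Φ⊆⟨F⟩ Φf)

mainTheorem4 : ∀ {c ℓ} (R : CommutativeRing c ℓ) → IsNoetherian R →
    (n : ℕ) → 1 ≤ n →
    (Φ : Poly R n → Set (c ⊔ ℓ)) →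
    ((F : List (Poly R n)) → All Φ F →
      ∃ λ (u : Vec (CommutativeRing.Carrier R) n) →
        All (λ f → CommutativeRing._≈_ R (eval R f u) (CommutativeRing.0# R)) F) →
    ∃ λ (u : Vec (CommutativeRing.Carrier R) n) →
      ∀ f → Φ f → CommutativeRing._≈_ R (eval R f u) (CommutativeRing.0# R)
mainTheorem4 R noeth n _ Φ solvable =
  let u , Φ-vanish = commonZero R noeth n (λ f → Φ (toPoly R f)) solvableₚ
  in u , λ f Φf → subst (_≈ 0#) (eval-fromPoly R n f u)
                    (Φ-vanish (fromPoly R n f) (subst Φ (≡.sym (toPoly-fromPoly R n f)) Φf))
  where
  open CommutativeRing R using (_≈_; 0#)

  solvableₚ : (F : List (Pol R n)) → All (λ f → Φ (toPoly R f)) F → ∃ λ u → All (VanishesAt R u) F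
  solvableₚ F ΦF =
    let u , F-vanish = solvable (map (toPoly R) F) (map⁺ ΦF)
    in u , All.map (λ {f} → subst (_≈ 0#) (eval-toPoly R f u)) (map⁻ F-vanish)
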